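{- Let $G$ be an $(S_{1,2,5},S_{3,3,3})$-free chordal bipartite graph, and let $(u_1,v_1,u_2,v_2,u_3)$ be an induced path $P_5$ in $G$ (edges $u_1v_1,v_1u_2,u_2v_2,v_2u_3$). Suppose $D$ is an efficient dominating set of $G$ with $u_2\in D$. Then there exist vertices $v,v'\in D$ such that $(v,u_1,v_1,u_2,v_2,u_3,v')$ is an induced path $P_7$ in $G$ (so $u_2$ is the midpoint of this $P_7$), and $v,v'$ are $u_2$-forced, i.e., $v,v'\in D'$ for every efficient dominating set $D'$ of $G$ with $u_2\in D'$.
   Context: All graphs are finite, simple and undirected. A set $D\subseteq V(G)$ is an efficient dominating set of $G$ if $|D\cap N[w]|=1$ for every vertex $w$, where $N[w]$ is the closed neighbourhood of $w$. For $i,j,k\ge0$, $S_{i,j,k}$ is the tree formed by a center $u$ and three induced paths from $u$ with $i$, $j$, $k$ further vertices respectively, pairwise sharing only $u$. A bipartite graph is chordal bipartite if it has no induced cycle $C_{2k}$ with $k\ge3$. $G$ is $(S_{1,2,5},S_{3,3,3})$-free if it contains neither $S_{1,2,5}$ nor $S_{3,3,3}$ as an induced subgraph. -}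

module Defs where

open import Data.Nat using (ℕ; zero; suc; _+_; _*_; _≤_; _≡ᵇ_)
open import Data.Bool using (Bool; true; false; _∧_; _∨_; not)
open import Data.Fin using (Fin; toℕ)
open import Data.Vec using (Vec; lookup)
open import Data.Product using (Σ; ∃; ∃-syntax; _×_; _,_)
open import Data.Sum using (_⊎_)
open import Relation.Nullary using (¬_)
open import Relation.Binary.PropositionalEquality using (_≡_; _≢_)
open import Function.Definitions using (Injective)

record Graph (n : ℕ) : Set where
  field
    adj    : Fin n → Fin n → Bool
    sym    : ∀ u v → adj u v ≡ adj v u
    irrefl : ∀ u → adj u u ≡ false
open Graph public

Edge : ∀ {n} → Graph n → Fin n → Fin n → Set
Edge G u v = adj G u v ≡ true

IsInducedCopy : ∀ {m n} → (Fin m → Fin m → Bool) → Graph n → (Fin m → Fin n) → Set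
IsInducedCopy h G f = Injective _≡_ _≡_ f × (∀ a b → adj G (f a) (f b) ≡ h a b)

Contains : ∀ {m n} → (Fin m → Fin m → Bool) → Graph n → Set
Contains h G = ∃[ f ] IsInducedCopy h G f

Free : ∀ {m n} → (Fin m → Fin m → Bool) → Graph n → Set
Free h G = ¬ Contains h G

pathAdj : ∀ {m} → Fin m → Fin m → Bool
pathAdj a b = (suc (toℕ a) ≡ᵇ toℕ b) ∨ (suc (toℕ b) ≡ᵇ toℕ a)

-- Cycle C_m on vertices 0,...,m-1 (path plus edge 0 — m-1); used for m ≥ 6.
cycAdj : ∀ {m} → Fin m → Fin m → Bool
cycAdj {m} a b = pathAdj a b
  ∨ ((toℕ a ≡ᵇ 0) ∧ (suc (toℕ b) ≡ᵇ m))
  ∨ ((toℕ b ≡ᵇ 0) ∧ (suc (toℕ a) ≡ᵇ m))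

-- S_{i,j,k} on vertices 0..i+j+k: 0 is the center u; the three paths are
-- 1..i, i+1..i+j, i+j+1..i+j+k (each attached to 0 at its first vertex).
sEdge : ℕ → ℕ → ℕ → ℕ → ℕ → Bool
sEdge i j k a b =
  ((a ≡ᵇ 0) ∧ ((b ≡ᵇ 1) ∨ (b ≡ᵇ suc i) ∨ (b ≡ᵇ suc (i + j))))
  ∨ (not (a ≡ᵇ 0) ∧ (b ≡ᵇ suc a) ∧ not (a ≡ᵇ i) ∧ not (a ≡ᵇ i + j))

SAdj : (i j k : ℕ) → Fin (suc (i + j + k)) → Fin (suc (i + j + k)) → Bool
SAdj i j k x y = sEdge i j k (toℕ x) (toℕ y) ∨ sEdge i j k (toℕ y) (toℕ x)

Bipartite : ∀ {n} → Graph n → Set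
Bipartite {n} G = Σ (Fin n → Bool) λ c → ∀ (u v : Fin n) → Edge G u v → c u ≢ c v

ChordalBipartite : ∀ {n} → Graph n → Set
ChordalBipartite G = Bipartite G × (∀ k → 3 ≤ k → Free (cycAdj {2 * k}) G)

InducedPath : ∀ {n m} → Graph n → Vec (Fin n) m → Set
InducedPath G p = IsInducedCopy pathAdj G (lookup p)

InClosedNbhd : ∀ {n} → Graph n → Fin n → Fin n → Set
InClosedNbhd G w d = d ≡ w ⊎ Edge G w d

EDS : ∀ {n} → Graph n → (Fin n → Bool) → Set
EDS {n} G D = ∀ (w : Fin n) → ∃[ d ] ((D d ≡ true × InClosedNbhd G w d)
                × (∀ d' → D d' ≡ true → InClosedNbhd G w d' → d' ≡ d))

Forced : ∀ {n} → Graph n → Fin n → Fin n → Set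
Forced G x y = ∀ D' → EDS G D' → D' x ≡ true → D' y ≡ true

-- Proof idea: the D-dominator v of u₁ is adjacent to no other vertex of the P₅: not to v₁, v₂
-- (bipartiteness), not to u₂ (D is independent), and not to u₃, which would close an induced C₆.
-- Doing the same at u₃ gives the P₇. If an efficient dominating set D′ ∋ u₂ dominated u₁ by some
-- w ≠ v, then w ∉ D, and w, its D-dominator x, v and the P₇ would form an induced S₁,₂,₅
-- centred at u₁.
module Submission where

open import Defs hiding (sym)
open import Data.Nat using (ℕ; suc; _≡ᵇ_; _∸_)
import Data.Nat as ℕ
open import Data.Nat.Properties using (∸-cancelˡ-≡; +-∸-assoc; <⇒≤; ≤-refl)
open import Data.Bool using (Bool; true; false; _∨_; not)
import Data.Bool.Properties as Bool
open import Data.Fin using (Fin; zero; suc; toℕ; opposite; fromℕ; inject₁; _≟_; #_)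
open import Data.Fin.Properties
  using (all?; any?; opposite-prop; opposite-involutive; toℕ<n; suc-injective; inject₁-injective; toℕ-inject₁)
open import Data.Vec using (Vec; _∷_; []; lookup; reverse; _∷ʳ_)
open import Data.Vec.Properties using (reverse-∷)
open import Data.Product using (∃-syntax; _×_; _,_; proj₁; proj₂)
open import Data.Sum using (_⊎_; inj₁; inj₂)
open import Data.Unit using (⊤; tt)
open import Data.Empty using (⊥-elim)
open import Function using (_∘_)
open import Function.Bundles using (mk⇔)
open import Function.Definitions using (Injective)
open import Relation.Nullary using (Dec; ¬_; ¬?)
open import Relation.Nullary.Decidable using (True; toWitness; map′; _×-dec_; _⊎-dec_; does-⇔)
open import Relation.Binary.PropositionalEquality
  using (_≡_; _≢_; _≗_; refl; sym; trans; cong; cong₂; subst; module ≡-Reasoning)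

true≢false : true ≢ false
true≢false ()

record IsSimplePattern {m} (h : Fin m → Fin m → Bool) : Set where
  field
    symmetric   : ∀ a b → h a b ≡ h b a
    irreflexive : ∀ a → h a a ≡ false
    twin-free   : ∀ a b → a ≡ b ⊎ h a b ≡ true ⊎ ∃[ c ] h a c ≢ h b c

isSimplePattern? : ∀ {m} (h : Fin m → Fin m → Bool) → Dec (IsSimplePattern h)
isSimplePattern? h =
  map′ (λ (s , i , t) → record { symmetric = s ; irreflexive = i ; twin-free = t })
       (λ p → IsSimplePattern.symmetric p , IsSimplePattern.irreflexive p , IsSimplePattern.twin-free p)
       (all? (λ a → all? λ b → h a b Bool.≟ h b a)
        ×-dec all? (λ a → h a a Bool.≟ false)
        ×-dec all? (λ a → all? λ b →
                a ≟ b ⊎-dec h a b Bool.≟ true ⊎-dec any? λ c → ¬? (h a c Bool.≟ h b c)))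

lookup-∷ʳ-last : ∀ {A : Set} {k} (xs : Vec A k) x → lookup (xs ∷ʳ x) (fromℕ k) ≡ x
lookup-∷ʳ-last []       x = refl
lookup-∷ʳ-last (_ ∷ xs) x = lookup-∷ʳ-last xs x

lookup-∷ʳ-inject₁ : ∀ {A : Set} {k} (xs : Vec A k) x i → lookup (xs ∷ʳ x) (inject₁ i) ≡ lookup xs i
lookup-∷ʳ-inject₁ (_ ∷ xs) x zero    = refl
lookup-∷ʳ-inject₁ (_ ∷ xs) x (suc i) = lookup-∷ʳ-inject₁ xs x i

lookup-reverse-opposite : ∀ {A : Set} {k} (xs : Vec A k) i → lookup (reverse xs) (opposite i) ≡ lookup xs i
lookup-reverse-opposite (x ∷ xs) i = begin
  lookup (reverse (x ∷ xs)) (opposite i) ≡⟨ cong (λ v → lookup v (opposite i)) (reverse-∷ x xs) ⟩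
  lookup (reverse xs ∷ʳ x) (opposite i)  ≡⟨ lookup-snoc i ⟩
  lookup (x ∷ xs) i                      ∎
  where
  open ≡-Reasoning
  lookup-snoc : ∀ i → lookup (reverse xs ∷ʳ x) (opposite i) ≡ lookup (x ∷ xs) i
  lookup-snoc zero    = lookup-∷ʳ-last (reverse xs) x
  lookup-snoc (suc i) = trans (lookup-∷ʳ-inject₁ (reverse xs) x (opposite i)) (lookup-reverse-opposite xs i)

lookup-reverse : ∀ {A : Set} {k} (xs : Vec A k) i → lookup (reverse xs) i ≡ lookup xs (opposite i)
lookup-reverse xs i =
  trans (cong (lookup (reverse xs)) (sym (opposite-involutive i))) (lookup-reverse-opposite xs (opposite i))

opposite-injective : ∀ {m} → Injective _≡_ _≡_ (opposite {m})
opposite-injective {_} {a} {b} e =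
  trans (sym (opposite-involutive a)) (trans (cong opposite e) (opposite-involutive b))

opposite-suc≡ᵇ : ∀ {m} (a b : Fin m)
  → (suc (toℕ (opposite a)) ≡ᵇ toℕ (opposite b)) ≡ (suc (toℕ b) ≡ᵇ toℕ a)
opposite-suc≡ᵇ {m} a b = does-⇔ (mk⇔ to from) (_ ℕ.≟ _) (_ ℕ.≟ _)
  where
  suc-opposite : ∀ i → suc (toℕ (opposite i)) ≡ m ∸ toℕ i
  suc-opposite i = trans (cong suc (opposite-prop i)) (sym (+-∸-assoc 1 (toℕ<n i)))
  to : suc (toℕ (opposite a)) ≡ toℕ (opposite b) → suc (toℕ b) ≡ toℕ a
  to e = sym (∸-cancelˡ-≡ (<⇒≤ (toℕ<n a)) (toℕ<n b)
           (trans (sym (suc-opposite a)) (trans e (opposite-prop b))))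
  from : suc (toℕ b) ≡ toℕ a → suc (toℕ (opposite a)) ≡ toℕ (opposite b)
  from e = trans (suc-opposite a) (trans (cong (m ∸_) (sym e)) (sym (opposite-prop b)))

pathAdj-opposite : ∀ {m} (a b : Fin m) → pathAdj (opposite a) (opposite b) ≡ pathAdj a b
pathAdj-opposite a b =
  trans (cong₂ _∨_ (opposite-suc≡ᵇ a b) (opposite-suc≡ᵇ b a)) (Bool.∨-comm (suc (toℕ b) ≡ᵇ toℕ a) _)

pathAdj-inject₁ : ∀ {m} (a b : Fin m) → pathAdj (inject₁ a) (inject₁ b) ≡ pathAdj a b
pathAdj-inject₁ a b = cong₂ (λ i j → (suc i ≡ᵇ j) ∨ (suc j ≡ᵇ i)) (toℕ-inject₁ a) (toℕ-inject₁ b)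

-- The adjacencies of all pairs i < j of a vertex list, as nested pairs: an induced copy of a
-- concrete pattern can then be written down as a tuple of adjacency facts.
Row : ∀ {n k} → Graph n → Fin n → (Fin k → Bool) → Vec (Fin n) k → Set
Row G x r []                = ⊤
Row G x r (y ∷ [])          = adj G x y ≡ r zero
Row G x r (y ∷ ys@(_ ∷ _)) = adj G x y ≡ r zero × Row G x (r ∘ suc) ys

Table : ∀ {n m} → Graph n → (Fin m → Fin m → Bool) → Vec (Fin n) m → Set
Table G h []                    = ⊤
Table G h (x ∷ [])              = ⊤
Table G h (x ∷ y ∷ [])          = Row G x (h zero ∘ suc) (y ∷ [])
Table G h (x ∷ xs@(_ ∷ _ ∷ _)) = Row G x (h zero ∘ suc) xs × Table G (λ a b → h (suc a) (suc b)) xs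

module _ {n} (G : Graph n) where

  adj-flip : ∀ {x y b} → adj G x y ≡ b → adj G y x ≡ b
  adj-flip {x} {y} e = trans (Graph.sym G y x) e

  nonadjacent : ∀ {x y} → ¬ Edge G x y → adj G x y ≡ false
  nonadjacent = Bool.¬-not

  row-lookup : ∀ {k x} {r : Fin k → Bool} ys → Row G x r ys → ∀ j → adj G x (lookup ys j) ≡ r j
  row-lookup (y ∷ [])    e        zero    = e
  row-lookup (y ∷ _ ∷ _) (e , _)  zero    = e
  row-lookup (y ∷ _ ∷ _) (_ , es) (suc j) = row-lookup _ es j

  row-tabulate : ∀ {k x} {r : Fin k → Bool} ys → (∀ j → adj G x (lookup ys j) ≡ r j) → Row G x r ys
  row-tabulate []          e = tt
  row-tabulate (y ∷ [])    e = e zero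
  row-tabulate (y ∷ _ ∷ _) e = e zero , row-tabulate _ (e ∘ suc)

  table-uncons : ∀ {m} {h : Fin (suc m) → Fin (suc m) → Bool} x xs → Table G h (x ∷ xs)
    → Row G x (h zero ∘ suc) xs × Table G (λ a b → h (suc a) (suc b)) xs
  table-uncons x []          t = tt , tt
  table-uncons x (y ∷ [])    t = t , tt
  table-uncons x (y ∷ _ ∷ _) t = t

  table-cons : ∀ {m} {h : Fin (suc m) → Fin (suc m) → Bool} x xs
    → Row G x (h zero ∘ suc) xs → Table G (λ a b → h (suc a) (suc b)) xs → Table G h (x ∷ xs)
  table-cons x []          r t = tt
  table-cons x (y ∷ [])    r t = r
  table-cons x (y ∷ _ ∷ _) r t = r , t

  table-tabulate : ∀ {m} {h : Fin m → Fin m → Bool} xs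
    → (∀ a b → adj G (lookup xs a) (lookup xs b) ≡ h a b) → Table G h xs
  table-tabulate []       e = tt
  table-tabulate (x ∷ xs) e =
    table-cons x xs (row-tabulate xs (e zero ∘ suc)) (table-tabulate xs λ a b → e (suc a) (suc b))

  table-lookup : ∀ {m} {h : Fin m → Fin m → Bool} → (∀ a b → h a b ≡ h b a) → (∀ a → h a a ≡ false)
    → ∀ xs → Table G h xs → ∀ a b → adj G (lookup xs a) (lookup xs b) ≡ h a b
  table-lookup h-sym h-irr (x ∷ xs) t zero    zero    = trans (irrefl G x) (sym (h-irr zero))
  table-lookup h-sym h-irr (x ∷ xs) t zero    (suc b) = row-lookup xs (proj₁ (table-uncons x xs t)) b
  table-lookup h-sym h-irr (x ∷ xs) t (suc a) zero    =
    trans (adj-flip (row-lookup xs (proj₁ (table-uncons x xs t)) a)) (h-sym zero (suc a))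
  table-lookup h-sym h-irr (x ∷ xs) t (suc a) (suc b) =
    table-lookup (λ a b → h-sym (suc a) (suc b)) (h-irr ∘ suc) xs (proj₂ (table-uncons x xs t)) a b

  twin-free⇒injective : ∀ {m} {h : Fin m → Fin m → Bool} {f : Fin m → Fin n}
    → (∀ a b → a ≡ b ⊎ h a b ≡ true ⊎ ∃[ c ] h a c ≢ h b c)
    → (∀ a b → adj G (f a) (f b) ≡ h a b) → Injective _≡_ _≡_ f
  twin-free⇒injective {f = f} twin-free f-adj {a} {b} fa≡fb with twin-free a b
  ... | inj₁ a≡b             = a≡b
  ... | inj₂ (inj₁ hab)      = ⊥-elim (true≢false (begin
    true                   ≡⟨ hab ⟨
    _                      ≡⟨ f-adj a b ⟨
    adj G (f a) (f b)      ≡⟨ cong (adj G (f a)) fa≡fb ⟨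
    adj G (f a) (f a)      ≡⟨ irrefl G (f a) ⟩
    false                  ∎))
    where open ≡-Reasoning
  ... | inj₂ (inj₂ (c , ne)) =
    ⊥-elim (ne (trans (sym (f-adj a c)) (trans (cong (λ z → adj G z (f c)) fa≡fb) (f-adj b c))))

  table⇒IsInducedCopy : ∀ {m} {h : Fin m → Fin m → Bool} xs → {True (isSimplePattern? h)}
    → Table G h xs → IsInducedCopy h G (lookup xs)
  table⇒IsInducedCopy xs {simple} t = twin-free⇒injective twin-free adjacency , adjacency
    where
    open IsSimplePattern (toWitness simple)
    adjacency = table-lookup symmetric irreflexive xs t

  IsInducedCopy-∘ : ∀ {k m} {h : Fin m → Fin m → Bool} {h′ : Fin k → Fin k → Bool} {f σ}
    → Injective _≡_ _≡_ σ → (∀ a b → h (σ a) (σ b) ≡ h′ a b)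
    → IsInducedCopy h G f → IsInducedCopy h′ G (f ∘ σ)
  IsInducedCopy-∘ σ-injective σ-adj (f-injective , f-adj) =
    σ-injective ∘ f-injective , λ a b → trans (f-adj _ _) (σ-adj a b)

  IsInducedCopy-cong : ∀ {m} {h : Fin m → Fin m → Bool} {f g}
    → f ≗ g → IsInducedCopy h G f → IsInducedCopy h G g
  IsInducedCopy-cong f≗g (f-injective , f-adj) =
    (λ e → f-injective (trans (f≗g _) (trans e (sym (f≗g _))))) ,
    λ a b → trans (cong₂ (adj G) (sym (f≗g a)) (sym (f≗g b))) (f-adj a b)

  InducedPath-reverse : ∀ {m} (xs : Vec (Fin n) m) → InducedPath G xs → InducedPath G (reverse xs)
  InducedPath-reverse xs =
    IsInducedCopy-cong (sym ∘ lookup-reverse xs) ∘ IsInducedCopy-∘ opposite-injective pathAdj-opposite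

  InducedPath-tail : ∀ {m x} (xs : Vec (Fin n) m) → InducedPath G (x ∷ xs) → InducedPath G xs
  InducedPath-tail xs = IsInducedCopy-∘ suc-injective λ _ _ → refl

  InducedPath-init : ∀ {m} (xs : Vec (Fin n) m) {x} → InducedPath G (xs ∷ʳ x) → InducedPath G xs
  InducedPath-init xs {x} =
    IsInducedCopy-cong (lookup-∷ʳ-inject₁ xs x) ∘ IsInducedCopy-∘ inject₁-injective pathAdj-inject₁

  glue-P6s : ∀ {v u₁ v₁ u₂ v₂ u₃ v'}
    → InducedPath G (v ∷ u₁ ∷ v₁ ∷ u₂ ∷ v₂ ∷ u₃ ∷ [])
    → InducedPath G (v' ∷ u₃ ∷ v₂ ∷ u₂ ∷ v₁ ∷ u₁ ∷ [])
    → adj G v v' ≡ false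
    → InducedPath G (v ∷ u₁ ∷ v₁ ∷ u₂ ∷ v₂ ∷ u₃ ∷ v' ∷ [])
  glue-P6s {v} {u₁} {v₁} {u₂} {v₂} {u₃} {v'} left right vv'
    with table-tabulate (v ∷ u₁ ∷ v₁ ∷ u₂ ∷ v₂ ∷ u₃ ∷ []) (proj₂ left)
       | table-tabulate (v' ∷ u₃ ∷ v₂ ∷ u₂ ∷ v₁ ∷ u₁ ∷ []) (proj₂ right)
  ... | (vu₁ , vv₁ , vu₂ , vv₂ , vu₃) , (u₁v₁ , u₁u₂ , u₁v₂ , u₁u₃)
        , (v₁u₂ , v₁v₂ , v₁u₃) , (u₂v₂ , u₂u₃) , v₂u₃
      | (v'u₃ , v'v₂ , v'u₂ , v'v₁ , v'u₁) , _ =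
    table⇒IsInducedCopy (v ∷ u₁ ∷ v₁ ∷ u₂ ∷ v₂ ∷ u₃ ∷ v' ∷ [])
      ( (vu₁ , vv₁ , vu₂ , vv₂ , vu₃ , vv')
      , (u₁v₁ , u₁u₂ , u₁v₂ , u₁u₃ , adj-flip v'u₁)
      , (v₁u₂ , v₁v₂ , v₁u₃ , adj-flip v'v₁)
      , (u₂v₂ , u₂u₃ , adj-flip v'u₂)
      , (v₂u₃ , adj-flip v'v₂)
      , adj-flip v'u₃ )

  module _ {D : Fin n → Bool} (eds : EDS G D) where

    eds-unique : ∀ {w a b} → D a ≡ true → D b ≡ true → InClosedNbhd G w a → InClosedNbhd G w b → a ≡ b
    eds-unique {w} Da Db wa wb with eds w
    ... | _ , _ , only = trans (only _ Da wa) (sym (only _ Db wb))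

    eds-independent : ∀ {a b} → D a ≡ true → D b ≡ true → adj G a b ≡ false
    eds-independent {a} Da Db = nonadjacent λ ab →
      true≢false (trans (sym ab)
        (trans (cong (adj G a) (sym (eds-unique Da Db (inj₁ refl) (inj₂ ab)))) (irrefl G a)))

  module _ (c : Fin n → Bool) (proper : ∀ u v → Edge G u v → c u ≢ c v) where

    colour-swap : ∀ {x y} → Edge G x y → c y ≡ not (c x)
    colour-swap {x} {y} xy = Bool.¬-not λ e → proper x y xy (sym e)

    colour-two-steps : ∀ {x y z} → Edge G x y → Edge G y z → c z ≡ c x
    colour-two-steps xy yz = trans (colour-swap yz) (trans (cong not (colour-swap xy)) (Bool.not-involutive _))

    same-colour-nonadjacent : ∀ {x y} → c x ≡ c y → adj G x y ≡ false
    same-colour-nonadjacent {x} {y} e = nonadjacent λ xy → proper x y xy e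

    module _ (C6-free : Free (cycAdj {6}) G) where

      dominator-extends-P5 : ∀ {D} → EDS G D → ∀ {u₁ v₁ u₂ v₂ u₃} → D u₂ ≡ true
        → InducedPath G (u₁ ∷ v₁ ∷ u₂ ∷ v₂ ∷ u₃ ∷ [])
        → ∃[ v ] D v ≡ true × InducedPath G (v ∷ u₁ ∷ v₁ ∷ u₂ ∷ v₂ ∷ u₃ ∷ [])
      dominator-extends-P5 eds {u₁} {v₁} {u₂} {v₂} {u₃} Du₂ (injective , P) with eds u₁
      ... | v , (Dv , inj₂ u₁v) , _ =
        v , Dv , table⇒IsInducedCopy (v ∷ P₅)
                   ((vu₁ , vv₁ , vu₂ , vv₂ , nonadjacent v≁u₃) , table-tabulate P₅ P)
        where
        P₅ = u₁ ∷ v₁ ∷ u₂ ∷ v₂ ∷ u₃ ∷ []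
        vu₁ : adj G v u₁ ≡ true
        vu₁ = adj-flip u₁v
        vv₁ : adj G v v₁ ≡ false
        vv₁ = same-colour-nonadjacent (colour-two-steps (P (# 1) (# 0)) u₁v)
        vu₂ : adj G v u₂ ≡ false
        vu₂ = eds-independent eds Dv Du₂
        vv₂ : adj G v v₂ ≡ false
        vv₂ = same-colour-nonadjacent (trans (colour-two-steps (P (# 1) (# 0)) u₁v)
                (sym (colour-two-steps (P (# 1) (# 2)) (P (# 2) (# 3)))))
        v≁u₃ : ¬ Edge G v u₃
        v≁u₃ vu₃ = C6-free
          (_ , table⇒IsInducedCopy (v ∷ P₅) ((vu₁ , vv₁ , vu₂ , vv₂ , vu₃) , table-tabulate P₅ P))
      ... | _ , (Du₁ , inj₁ refl) , _
        with injective {# 0} {# 2} (eds-unique eds Du₁ Du₂ (inj₂ (P (# 1) (# 0))) (inj₂ (P (# 1) (# 2))))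
      ... | ()

      module _ (S125-free : Free (SAdj 1 2 5) G) where

        extension-in-D : ∀ {D} → EDS G D → ∀ {v u₁ v₁ u₂ v₂ u₃ v' w}
          → D v ≡ true → D u₂ ≡ true → D v' ≡ true
          → InducedPath G (v ∷ u₁ ∷ v₁ ∷ u₂ ∷ v₂ ∷ u₃ ∷ v' ∷ [])
          → InducedPath G (w ∷ u₁ ∷ v₁ ∷ u₂ ∷ v₂ ∷ u₃ ∷ []) → D w ≡ true
        extension-in-D {D} eds {v} {u₁} {v₁} {u₂} {v₂} {u₃} {v'} {w} Dv Du₂ Dv' p₇ p₆ with D w in Dw
        ... | true = refl
        ... | false
          with table-tabulate (v ∷ u₁ ∷ v₁ ∷ u₂ ∷ v₂ ∷ u₃ ∷ v' ∷ []) (proj₂ p₇)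
             | table-tabulate (w ∷ u₁ ∷ v₁ ∷ u₂ ∷ v₂ ∷ u₃ ∷ []) (proj₂ p₆)
             | eds w
        ... | (vu₁ , rowV) , rowU₁ , rest | (wu₁ , wv₁ , wu₂ , wv₂ , wu₃) , _ | x , (Dx , inj₂ wx) , _ =
          ⊥-elim (S125-free (_ , table⇒IsInducedCopy (u₁ ∷ v ∷ w ∷ x ∷ v₁ ∷ u₂ ∷ v₂ ∷ u₃ ∷ v' ∷ [])
            ( (adj-flip vu₁ , adj-flip wu₁ , u₁x , rowU₁)
            , (vw , eds-independent eds Dv Dx , rowV)
            , (wx , wv₁ , wu₂ , wv₂ , wu₃ , wv')
            , (x≁N[u₂] (P (# 2) (# 3)) , xu₂ , x≁N[u₂] (P (# 4) (# 3)) , xu₃ , eds-independent eds Dx Dv')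
            , rest )))
          where
          P = proj₂ p₇
          cu₂ : c u₂ ≡ c u₁
          cu₂ = colour-two-steps (P (# 1) (# 2)) (P (# 2) (# 3))
          cu₃ : c u₃ ≡ c u₁
          cu₃ = trans (colour-two-steps (P (# 3) (# 4)) (P (# 4) (# 5))) cu₂
          cv' : c v' ≡ c v
          cv' = trans (colour-two-steps (P (# 4) (# 5)) (P (# 5) (# 6)))
                  (trans (colour-two-steps (P (# 2) (# 3)) (P (# 3) (# 4)))
                         (colour-two-steps (P (# 0) (# 1)) (P (# 1) (# 2))))
          cw : c w ≡ c v
          cw = colour-two-steps vu₁ (adj-flip wu₁)
          cx : c x ≡ c u₁
          cx = colour-two-steps (adj-flip wu₁) wx
          u₁x : adj G u₁ x ≡ false
          u₁x = same-colour-nonadjacent (sym cx)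
          vw : adj G v w ≡ false
          vw = same-colour-nonadjacent (sym cw)
          wv' : adj G w v' ≡ false
          wv' = same-colour-nonadjacent (trans cw (sym cv'))
          xu₂ : adj G x u₂ ≡ false
          xu₂ = same-colour-nonadjacent (trans cx (sym cu₂))
          xu₃ : adj G x u₃ ≡ false
          xu₃ = same-colour-nonadjacent (trans cx (sym cu₃))
          x≁N[u₂] : ∀ {y} → Edge G y u₂ → adj G x y ≡ false
          x≁N[u₂] yu₂ = nonadjacent λ xy → true≢false
            (trans (sym (subst (Edge G w) (eds-unique eds Dx Du₂ (inj₂ (adj-flip xy)) (inj₂ yu₂)) wx)) wu₂)
        ... | _ | _ | _ , (Dx , inj₁ refl) , _ = ⊥-elim (true≢false (trans (sym Dx) Dw))

        dominator-forced : ∀ {D} → EDS G D → ∀ {v u₁ v₁ u₂ v₂ u₃ v'}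
          → D v ≡ true → D u₂ ≡ true → D v' ≡ true
          → InducedPath G (v ∷ u₁ ∷ v₁ ∷ u₂ ∷ v₂ ∷ u₃ ∷ v' ∷ []) → Forced G u₂ v
        dominator-forced eds {v} {u₁} {v₁} {u₂} {v₂} {u₃} {v'} Dv Du₂ Dv' p₇ D' eds' D'u₂ =
          let w , D'w , p₆ = dominator-extends-P5 eds' D'u₂ p₅
              w≡v = eds-unique eds (extension-in-D eds Dv Du₂ Dv' p₇ p₆) Dv
                      (inj₂ (proj₂ p₆ (# 1) (# 0))) (inj₂ (proj₂ p₇ (# 1) (# 0)))
          in subst (λ z → D' z ≡ true) w≡v D'w
          where
          P₅ = u₁ ∷ v₁ ∷ u₂ ∷ v₂ ∷ u₃ ∷ []
          p₅ : InducedPath G P₅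
          p₅ = InducedPath-init P₅ (InducedPath-tail (P₅ ∷ʳ v') p₇)

lemma1 : ∀ {n : ℕ} (G : Graph n)
    → Free (SAdj 1 2 5) G → Free (SAdj 3 3 3) G → ChordalBipartite G
    → (u₁ v₁ u₂ v₂ u₃ : Fin n)
    → InducedPath G (u₁ ∷ v₁ ∷ u₂ ∷ v₂ ∷ u₃ ∷ [])
    → (D : Fin n → Bool) → EDS G D → D u₂ ≡ true
    → ∃[ v ] ∃[ v' ] (D v ≡ true × D v' ≡ true
        × InducedPath G (v ∷ u₁ ∷ v₁ ∷ u₂ ∷ v₂ ∷ u₃ ∷ v' ∷ [])
        × Forced G u₂ v × Forced G u₂ v')
lemma1 G S125-free _ ((c , proper) , chordal) u₁ v₁ u₂ v₂ u₃ p₅ D eds Du₂ =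
  let v  , Dv  , p₆  = dominator-extends-P5 G c proper C6-free eds Du₂ p₅
      v' , Dv' , p₆' = dominator-extends-P5 G c proper C6-free eds Du₂ (InducedPath-reverse G P₅ p₅)
      p₇ = glue-P6s G p₆ p₆' (eds-independent G eds Dv Dv')
  in v , v' , Dv , Dv' , p₇ , forced eds Dv Du₂ Dv' p₇
   , forced eds Dv' Du₂ Dv (InducedPath-reverse G (v ∷ (P₅ ∷ʳ v')) p₇)
  where
  P₅ = u₁ ∷ v₁ ∷ u₂ ∷ v₂ ∷ u₃ ∷ []
  C6-free : Free (cycAdj {6}) G
  C6-free = chordal 3 ≤-refl
  forced = dominator-forced G c proper C6-free S125-free
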